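{- Let $m\ge1$ and let $\epsilon=(\epsilon_1,\dots,\epsilon_s)$ be a circular sequence with $\epsilon_i\in\{1,-1\}$ for all $i$. Then every free linear digraph of $\Gamma^m_\epsilon$ has at most $s$ vertices.
   Context: Indices are mod $s$. Digraph $\Gamma^m_\epsilon$: vertices $x_{i,t}$, $0\le i\le m-1$, $t\in\{1,\dots,s\}$, some "marked zero". If $s=1$: all vertices are marked zero, no edges. If $s\ge2$: for each $t$ let $A_t=\max(\epsilon_t,0)$, $B_t=\max(-\epsilon_{t+1},0)$; for each $j\in\{0,\dots,m-1\}$: if $j\ge\max(A_t,B_t)$ add an edge from $x_{j-A_t,t}$ to $x_{j-B_t,t+1}$ of weight $A_t-B_t$; if $A_t\le j<B_t$ mark $x_{j-A_t,t}$ zero; if $B_t\le j<A_t$ mark $x_{j-B_t,t+1}$ zero. Each connected component is a directed path (linear digraph) or a directed cycle; a linear digraph with no vertex marked zero is a free linear digraph; its length is its number of vertices. -}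

module Defs where

open import Data.Nat as ℕ using (ℕ; zero; suc; NonZero)
open import Data.Nat.DivMod using (_%_; m%n<n)
open import Data.Integer as ℤ using (ℤ; +_; -_; _⊔_; _-_)
open import Data.Fin using (Fin; toℕ; fromℕ<)
open import Data.Product using (_×_; _,_; ∃; ∃₂; Σ)
open import Data.Sum using (_⊎_)
open import Data.List using (List; []; _∷_; _++_)
open import Data.List.Membership.Propositional using (_∈_)
open import Relation.Binary.PropositionalEquality using (_≡_; _≢_)
open import Relation.Nullary using (¬_)
open import Data.List.Relation.Unary.All using (All)
open import Data.List.Relation.Unary.Linked using (Linked)
open import Data.List.Relation.Unary.Unique.Propositional using (Unique)

-- Circular index t ∈ Fin s stands for the paper's index t+1 ∈ {1,…,s}.
-- Successor modulo s.
next : ∀ {s} → Fin s → Fin s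
next {zero} ()
next {suc n} t = fromℕ< (m%n<n (suc (toℕ t)) (suc n))

module Γ (m s : ℕ) (ε : Fin s → ℤ) where

  Vertex : Set
  Vertex = Fin m × Fin s

  A : Fin s → ℤ
  A t = ε t ⊔ + 0

  B : Fin s → ℤ
  B t = (- ε (next t)) ⊔ + 0

  idx : Vertex → ℤ
  idx (i , t) = + toℕ i

  layer : Vertex → Fin s
  layer (i , t) = t

  -- directed edge u → v of Γ^m_ε (weights are irrelevant here)
  Edge : Vertex → Vertex → Set
  Edge u v = (2 ℕ.≤ s) × Σ (Fin s) λ t → Σ ℕ λ j →
    (j ℕ.< m) × (A t ℤ.≤ + j) × (B t ℤ.≤ + j) ×
    (idx u ≡ + j - A t) × (layer u ≡ t) ×
    (idx v ≡ + j - B t) × (layer v ≡ next t)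

  MarkedZero : Vertex → Set
  MarkedZero u = (s ≡ 1) ⊎ ((2 ℕ.≤ s) × Σ (Fin s) λ t → Σ ℕ λ j → (j ℕ.< m) ×
    (((A t ℤ.≤ + j) × (+ j ℤ.< B t) × (idx u ≡ + j - A t) × (layer u ≡ t))
     ⊎ ((B t ℤ.≤ + j) × (+ j ℤ.< A t) × (idx u ≡ + j - B t) × (layer u ≡ next t))))

  Consecutive : Vertex → Vertex → List Vertex → Set
  Consecutive u v vs = ∃₂ λ xs ys → vs ≡ xs ++ (u ∷ v ∷ ys)

  -- vs (a list of distinct vertices v₀,…,v_k) is a connected component of
  -- Γ^m_ε which is a linear digraph v₀ → v₁ → ⋯ → v_k:
  --  * consecutive vertices are joined by an edge,
  --  * the vertex set is closed under adjacency (so it is a whole component),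
  --  * the only edges between vertices of vs are the consecutive ones.
  record LinearComponent (vs : List Vertex) : Set where
    field
      distinct    : Unique vs
      nonempty    : vs ≢ []
      path        : Linked Edge vs
      closedOut   : ∀ u v → Edge u v → u ∈ vs → v ∈ vs
      closedIn    : ∀ u v → Edge u v → v ∈ vs → u ∈ vs
      onlyPath    : ∀ u v → u ∈ vs → v ∈ vs → Edge u v → Consecutive u v vs

  record FreeLinear (vs : List Vertex) : Set where
    field
      linear   : LinearComponent vs
      noneZero : All (λ u → ¬ MarkedZero u) vs

module Submission where

-- Put a_t = max(ε_t,0) and b_t = max(-ε_{t+1},0).  An edge x_{i,t} → x_{i',t+1}
-- forces i + a_t = i' + b_t, so along a path the index changes by an amount
-- depending on the layer only, and two paths starting in the same layer keep
-- a constant index difference ('parallel').  An unmarked vertex lacks an in-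
-- or out-edge only when the index leaves the range, so the first vertex v₀
-- and the last vertex of a free linear component sit at the top index m - 1
-- once a_t, b_t ≤ 1 ('head-top', 'last-top').  With more than s vertices, the
-- vertex y reached after s steps is in the layer of v₀; walking from v₀ and
-- from y in parallel until the end gives index(y) = m - 1, so y = v₀ occurs
-- twice.

open import Defs
open import Data.Nat using (ℕ; _≤_)
open import Data.Integer using (ℤ; +_; -_)
open import Data.Fin using (Fin)
open import Data.Sum using (_⊎_)
open import Data.List using (List; length)
open import Relation.Binary.PropositionalEquality using (_≡_)

open import Algebra.Bundles using (AbelianGroup)
open import Data.Nat using (zero; suc; NonZero; _<_; _+_; _∸_; z≤n; s≤s; _≤?_)
open import Data.Nat.Properties
  using ( ≤-refl; ≤-trans; ≤-reflexive; ≤-antisym; ≤-pred; ≤-<-trans; ≰⇒>; ≮⇒≥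
        ; m≤n⇒m≤1+n; m≤n+m; m∸n≤m; m∸n+n≡m; +-comm; +-suc; +-identityʳ
        ; +-cancelʳ-≡; +-cancelˡ-≤; +-monoˡ-≤; +-monoʳ-≤; +-commutativeSemigroup )
open import Algebra.Properties.CommutativeSemigroup +-commutativeSemigroup using (xy∙z≈xz∙y)
open import Data.Nat.DivMod using (_%_; m%n<n; %-distribˡ-+; m%n%n≡m%n; [m+n]%n≡m%n; m<n⇒m%n≡m)
open import Data.Nat.GeneralisedArithmetic using (iterate; fold; iterate-is-fold)
open import Data.Integer as ℤ using (+≤+; +<+)
open import Data.Integer.Properties using (+-injective; i≤j⊔i; 0≤i⇒+∣i∣≡i; +-0-abelianGroup)
open import Algebra.Properties.Group (AbelianGroup.group +-0-abelianGroup)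
  using (//-rightDividesˡ; //-rightDividesʳ)
open import Data.Fin using (toℕ; fromℕ<)
open import Data.Fin.Properties using (toℕ-fromℕ<; toℕ-injective; toℕ<n)
open import Data.Product using (Σ; _,_; _×_; proj₁; proj₂)
open import Data.Sum using (inj₁; inj₂)
open import Data.List using ([]; _∷_; _++_)
open import Data.List.Properties using (∷-injective)
open import Data.List.Membership.Propositional using (_∈_; _∉_)
open import Data.List.Membership.Propositional.Properties using (∈-++⁺ʳ)
open import Data.List.Relation.Unary.Any using (here; there)
open import Data.List.Relation.Unary.All as All using ()
open import Data.List.Relation.Unary.AllPairs using (_∷_)
open import Data.List.Relation.Unary.Linked as Linked using (Linked; _∷_)
open import Data.List.Relation.Unary.Unique.Propositional using (Unique)
open import Data.List.Relation.Unary.Unique.Propositional.Properties using (Unique[x∷xs]⇒x∉xs)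
open import Relation.Binary.PropositionalEquality using (refl; sym; trans; cong; cong₂; subst; module ≡-Reasoning)
open import Relation.Nullary using (¬_; Dec; yes; no)
open import Data.Empty using (⊥; ⊥-elim)

[m%d+k]%d≡[m+k]%d : ∀ x k d .{{_ : NonZero d}} → (x % d + k) % d ≡ (x + k) % d
[m%d+k]%d≡[m+k]%d x k d = begin
  (x % d + k) % d            ≡⟨ %-distribˡ-+ (x % d) k d ⟩
  (x % d % d + k % d) % d    ≡⟨ cong (λ r → (r + k % d) % d) (m%n%n≡m%n x d) ⟩
  (x % d + k % d) % d        ≡⟨ %-distribˡ-+ x k d ⟨
  (x + k) % d                ∎
  where open ≡-Reasoning

toℕ-next : ∀ {n} (t : Fin (suc n)) → toℕ (next t) ≡ suc (toℕ t) % suc n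
toℕ-next {n} t = toℕ-fromℕ< (m%n<n (suc (toℕ t)) (suc n))

toℕ-iterate-next : ∀ {n} k (t : Fin (suc n)) → toℕ (iterate next t k) ≡ (toℕ t + k) % suc n
toℕ-iterate-next {n} zero t = sym (begin
  (toℕ t + 0) % suc n  ≡⟨ cong (_% suc n) (+-identityʳ (toℕ t)) ⟩
  toℕ t % suc n        ≡⟨ m<n⇒m%n≡m (toℕ<n t) ⟩
  toℕ t                ∎)
  where open ≡-Reasoning
toℕ-iterate-next {n} (suc k) t = begin
  toℕ (iterate next (next t) k)        ≡⟨ toℕ-iterate-next k (next t) ⟩
  (toℕ (next t) + k) % suc n           ≡⟨ cong (λ r → (r + k) % suc n) (toℕ-next t) ⟩
  (suc (toℕ t) % suc n + k) % suc n    ≡⟨ [m%d+k]%d≡[m+k]%d (suc (toℕ t)) k (suc n) ⟩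
  (suc (toℕ t) + k) % suc n            ≡⟨ cong (_% suc n) (+-suc (toℕ t) k) ⟨
  (toℕ t + suc k) % suc n              ∎
  where open ≡-Reasoning

next-period : ∀ {n} (t : Fin (suc n)) → iterate next t (suc n) ≡ t
next-period {n} t = toℕ-injective (begin
  toℕ (iterate next t (suc n))  ≡⟨ toℕ-iterate-next (suc n) t ⟩
  (toℕ t + suc n) % suc n       ≡⟨ [m+n]%n≡m%n (toℕ t) (suc n) ⟩
  toℕ t % suc n                 ≡⟨ m<n⇒m%n≡m (toℕ<n t) ⟩
  toℕ t                         ∎)
  where open ≡-Reasoning

layer-count≢1⇒2≤ : ∀ {s} → Fin s → ¬ s ≡ 1 → 2 ≤ s
layer-count≢1⇒2≤ {suc zero}    _ s≢1 = ⊥-elim (s≢1 refl)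
layer-count≢1⇒2≤ {suc (suc _)} _ _   = s≤s (s≤s z≤n)

prev : ∀ {n} → Fin (suc n) → Fin (suc n)
prev {n} t = iterate next t n

next-prev : ∀ {n} (t : Fin (suc n)) → next (prev t) ≡ t
next-prev {n} t = begin
  next (iterate next t n)  ≡⟨ cong next (iterate-is-fold t next n) ⟨
  fold t next (suc n)      ≡⟨ iterate-is-fold t next (suc n) ⟩
  iterate next t (suc n)   ≡⟨ next-period t ⟩
  t                        ∎
  where open ≡-Reasoning

module _ {a} {A : Set a} where

  lastOf : A → List A → A
  lastOf x []       = x
  lastOf x (y ∷ ys) = lastOf y ys

  lastOf-∈ : ∀ (x : A) xs → lastOf x xs ∈ x ∷ xs
  lastOf-∈ x []       = here refl
  lastOf-∈ x (y ∷ ys) = there (lastOf-∈ y ys)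

  lastOf-suffix : ∀ (x : A) xs ys w zs → x ∷ xs ≡ ys ++ w ∷ zs → lastOf x xs ≡ lastOf w zs
  lastOf-suffix x xs        []           w zs refl = refl
  lastOf-suffix x []        (_ ∷ [])     w zs ()
  lastOf-suffix x []        (_ ∷ _ ∷ _)  w zs ()
  lastOf-suffix x (x' ∷ xs) (_ ∷ ys)     w zs eq = lastOf-suffix x' xs ys w zs (proj₂ (∷-injective eq))

  split-second∈tail : ∀ (x : A) xs ys u w zs → x ∷ xs ≡ ys ++ u ∷ w ∷ zs → w ∈ xs
  split-second∈tail x xs []       u w zs refl = here refl
  split-second∈tail x xs (y ∷ ys) u w zs refl = ∈-++⁺ʳ ys (there (here refl))

  unique-∉-after : ∀ xs (x : A) zs → Unique (xs ++ x ∷ zs) → x ∉ zs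
  unique-∉-after []       x zs u = Unique[x∷xs]⇒x∉xs u
  unique-∉-after (y ∷ xs) x zs (_ ∷ u) = unique-∉-after xs x zs u

≤-from-ℕ : ∀ {z c j} → z ≡ + c → c ≤ j → z ℤ.≤ + j
≤-from-ℕ refl = +≤+

<-from-ℕ : ∀ {z c j} → z ≡ + c → j < c → + j ℤ.< z
<-from-ℕ refl = +<+

sub-from-ℕ : ∀ {z c x j} → z ≡ + c → x + c ≡ j → + x ≡ + j ℤ.- z
sub-from-ℕ {c = c} {x} refl refl = sym (//-rightDividesʳ (+ c) (+ x))

sub-to-ℕ : ∀ {z c x j} → z ≡ + c → + x ≡ + j ℤ.- z → x + c ≡ j
sub-to-ℕ {c = c} {j = j} refl e = +-injective (trans (cong (ℤ._+ + c) e) (//-rightDividesˡ (+ c) (+ j)))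

-- One step of two parallel walks: equal increments preserve an index balance.
balance-step : ∀ {X X' Y Y' a b c d} → X + a ≡ X' + b → Y + a ≡ Y' + b →
  X + c ≡ Y + d → X' + c ≡ Y' + d
balance-step {X} {X'} {Y} {Y'} {a} {b} {c} {d} stepX stepY bal = +-cancelʳ-≡ b (X' + c) (Y' + d) (begin
  X' + c + b   ≡⟨ xy∙z≈xz∙y X' c b ⟩
  X' + b + c   ≡⟨ cong (_+ c) stepX ⟨
  X + a + c    ≡⟨ xy∙z≈xz∙y X a c ⟩
  X + c + a    ≡⟨ cong (_+ a) bal ⟩
  Y + d + a    ≡⟨ xy∙z≈xz∙y Y d a ⟩
  Y + a + d    ≡⟨ cong (_+ d) stepY ⟩
  Y' + b + d   ≡⟨ xy∙z≈xz∙y Y' b d ⟩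
  Y' + d + b   ∎)
  where open ≡-Reasoning

sum-of-tops : ∀ {M x y} → x ≤ M → y ≤ M → x + y ≡ M + M → y ≡ M
sum-of-tops {M} {x} {y} x≤M y≤M sum = ≤-antisym y≤M
  (+-cancelˡ-≤ M M y (subst (_≤ M + y) sum (+-monoˡ-≤ y x≤M)))

module Paths (m s : ℕ) (ε : Fin s → ℤ) where
  open Γ m s ε

  ix : Vertex → ℕ
  ix (i , _) = toℕ i

  a b : Fin s → ℕ
  a t = ℤ.∣ A t ∣
  b t = ℤ.∣ B t ∣

  A≡a : ∀ t → A t ≡ + a t
  A≡a t = sym (0≤i⇒+∣i∣≡i (i≤j⊔i (ε t) (+ 0)))

  B≡b : ∀ t → B t ≡ + b t
  B≡b t = sym (0≤i⇒+∣i∣≡i (i≤j⊔i (- ε (next t)) (+ 0)))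

  vertex-≡ : ∀ {u v} → ix u ≡ ix v → layer u ≡ layer v → u ≡ v
  vertex-≡ {_ , _} {_ , _} same-ix same-layer = cong₂ _,_ (toℕ-injective same-ix) same-layer

  edge-shift : ∀ {u v} → Edge u v → next (layer u) ≡ layer v × ix u + a (layer u) ≡ ix v + b (layer u)
  edge-shift {_ , .t} {_ , .(next t)} (_ , t , j , _ , _ , _ , eu , refl , ev , refl) =
    refl , trans (sub-to-ℕ (A≡a t) eu) (sym (sub-to-ℕ (B≡b t) ev))

  -- For s = 1 every vertex is marked zero.
  unmarked⇒2≤s : ∀ {u} → ¬ MarkedZero u → 2 ≤ s
  unmarked⇒2≤s {_ , t} unmarked = layer-count≢1⇒2≤ t (λ s≡1 → unmarked (inj₁ s≡1))

  -- An unmarked vertex x_{i,t} with i + a_t < m has an out-edge: otherwise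
  -- the pair (t, j = i + a_t) would mark it zero.
  out-edge : ∀ u → ¬ MarkedZero u → ix u + a (layer u) < m → Σ Vertex (Edge u)
  out-edge (i , t) unmarked j<m = extend (b t ≤? j)
    where
    j : ℕ
    j = toℕ i + a t
    A≤j : A t ℤ.≤ + j
    A≤j = ≤-from-ℕ (A≡a t) (m≤n+m (a t) (toℕ i))
    iu : + toℕ i ≡ + j ℤ.- A t
    iu = sub-from-ℕ (A≡a t) refl

    extend : Dec (b t ≤ j) → Σ Vertex (Edge (i , t))
    extend (yes b≤j) = (fromℕ< i'<m , next t) ,
      (unmarked⇒2≤s unmarked , t , j , j<m , A≤j , ≤-from-ℕ (B≡b t) b≤j , iu , refl , iv , refl)
      where
      i'<m : j ∸ b t < m
      i'<m = ≤-<-trans (m∸n≤m j (b t)) j<m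
      iv : + toℕ (fromℕ< i'<m) ≡ + j ℤ.- B t
      iv = sub-from-ℕ (B≡b t) (trans (cong (_+ b t) (toℕ-fromℕ< i'<m)) (m∸n+n≡m b≤j))
    extend (no b≰j) = ⊥-elim (unmarked (inj₂ (unmarked⇒2≤s unmarked , t , j , j<m ,
      inj₁ (A≤j , <-from-ℕ (B≡b t) (≰⇒> b≰j) , iu , refl))))

  in-edge : ∀ v t → next t ≡ layer v → ¬ MarkedZero v → ix v + b t < m → Σ Vertex (λ u → Edge u v)
  in-edge (i , t') t nt unmarked j<m = extend (a t ≤? j)
    where
    j : ℕ
    j = toℕ i + b t
    B≤j : B t ℤ.≤ + j
    B≤j = ≤-from-ℕ (B≡b t) (m≤n+m (b t) (toℕ i))
    iv : + toℕ i ≡ + j ℤ.- B t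
    iv = sub-from-ℕ (B≡b t) refl

    extend : Dec (a t ≤ j) → Σ Vertex (λ u → Edge u (i , t'))
    extend (yes a≤j) = (fromℕ< i'<m , t) ,
      (unmarked⇒2≤s unmarked , t , j , j<m , ≤-from-ℕ (A≡a t) a≤j , B≤j , iu , refl , iv , sym nt)
      where
      i'<m : j ∸ a t < m
      i'<m = ≤-<-trans (m∸n≤m j (a t)) j<m
      iu : + toℕ (fromℕ< i'<m) ≡ + j ℤ.- A t
      iu = sub-from-ℕ (A≡a t) (trans (cong (_+ a t) (toℕ-fromℕ< i'<m)) (m∸n+n≡m a≤j))
    extend (no a≰j) = ⊥-elim (unmarked (inj₂ (unmarked⇒2≤s unmarked , t , j , j<m ,
      inj₂ (B≤j , <-from-ℕ (A≡a t) (≰⇒> a≰j) , iv , sym nt))))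

  -- The first vertex of a linear component has no in-edge: its source would
  -- precede it in the list, i.e. occur twice.
  no-edge-into-head : ∀ {u v vs} → LinearComponent (v ∷ vs) → ¬ Edge u v
  no-edge-into-head {u} {v} {vs} lc e with onlyPath u v (closedIn u v e (here refl)) (here refl) e
    where open LinearComponent lc
  ... | xs , ys , split =
    Unique[x∷xs]⇒x∉xs (LinearComponent.distinct lc) (split-second∈tail v vs xs u v ys split)

  -- The last vertex of a linear component has no out-edge: its target would
  -- follow it in the list, so the last vertex would occur twice.
  no-edge-out-of-last : ∀ {v vs w} → LinearComponent (v ∷ vs) → ¬ Edge (lastOf v vs) w
  no-edge-out-of-last {v} {vs} {w} lc e
    with onlyPath (lastOf v vs) w (lastOf-∈ v vs) (closedOut (lastOf v vs) w e (lastOf-∈ v vs)) e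
    where open LinearComponent lc
  ... | xs , ys , split =
    unique-∉-after xs (lastOf v vs) (w ∷ ys) (subst Unique split (LinearComponent.distinct lc))
      (subst (_∈ w ∷ ys) (sym (lastOf-suffix v vs xs (lastOf v vs) (w ∷ ys) split)) (lastOf-∈ w ys))

  head-saturated : ∀ {v vs} t → FreeLinear (v ∷ vs) → next t ≡ layer v → m ≤ ix v + b t
  head-saturated {v} t fl nt = ≮⇒≥ λ j<m →
    no-edge-into-head linear (proj₂ (in-edge v t nt (All.head noneZero) j<m))
    where open FreeLinear fl

  last-saturated : ∀ {v vs} → FreeLinear (v ∷ vs) → m ≤ ix (lastOf v vs) + a (layer (lastOf v vs))
  last-saturated {v} {vs} fl = ≮⇒≥ λ j<m →
    no-edge-out-of-last linear (proj₂ (out-edge L (All.lookup noneZero (lastOf-∈ v vs)) j<m))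
    where
    open FreeLinear fl
    L : Vertex
    L = lastOf v vs

  record Landing (k : ℕ) (x : Vertex) (xs : List Vertex) : Set where
    field
      target     : Vertex
      remainder  : List Vertex
      onPath     : Linked Edge (target ∷ remainder)
      inLayer    : layer target ≡ iterate next (layer x) k
      sameLast   : lastOf target remainder ≡ lastOf x xs
      visited    : target ∈ x ∷ xs
      shorter    : length remainder ≤ length xs

  walk : ∀ k x xs → k ≤ length xs → Linked Edge (x ∷ xs) → Landing k x xs
  walk zero x xs _ path = record
    { target = x ; remainder = xs ; onPath = path ; inLayer = refl
    ; sameLast = refl ; visited = here refl ; shorter = ≤-refl }
  walk (suc k) x (x' ∷ xs) (s≤s k≤) (e ∷ path) = record
    { target = target ; remainder = remainder ; onPath = onPath
    ; inLayer = trans inLayer (cong (λ t → iterate next t k) (sym (proj₁ (edge-shift e))))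
    ; sameLast = sameLast ; visited = there visited ; shorter = m≤n⇒m≤1+n shorter }
    where open Landing (walk k x' xs k≤ path)

  -- Two paths starting in the same layer change their indices by the same
  -- amounts, so a balance  ix x + c = ix y + d  persists until the shorter
  -- path ends.
  parallel : ∀ {c d} x xs y ys → Linked Edge (x ∷ xs) → Linked Edge (y ∷ ys) →
    layer x ≡ layer y → length ys ≤ length xs → ix x + c ≡ ix y + d →
    Σ Vertex λ z → ix z + c ≡ ix (lastOf y ys) + d
  parallel x xs y [] _ _ _ _ bal = x , bal
  parallel (i , t) (x' ∷ xs) (i' , .t) (y' ∷ ys) (ex ∷ px) (ey ∷ py) refl (s≤s len) bal =
    parallel x' xs y' ys px py same-layer len
      (balance-step {toℕ i} {ix x'} {toℕ i'} {ix y'} (proj₂ (edge-shift ex)) (proj₂ (edge-shift ey)) bal)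
    where
    same-layer : layer x' ≡ layer y'
    same-layer = trans (sym (proj₁ (edge-shift ex))) (proj₁ (edge-shift ey))

module Signs (M n : ℕ) (ε : Fin (suc n) → ℤ) (ε±1 : ∀ t → ε t ≡ + 1 ⊎ ε t ≡ - (+ 1)) where
  open Γ (suc M) (suc n) ε
  open Paths (suc M) (suc n) ε

  a≤1 : ∀ t → a t ≤ 1
  a≤1 t with ε t | ε±1 t
  ... | _ | inj₁ refl = ≤-refl
  ... | _ | inj₂ refl = z≤n

  b≤1 : ∀ t → b t ≤ 1
  b≤1 t with ε (next t) | ε±1 (next t)
  ... | _ | inj₁ refl = z≤n
  ... | _ | inj₂ refl = ≤-refl

  ix≤M : ∀ v → ix v ≤ M
  ix≤M (i , _) = ≤-pred (toℕ<n i)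

  saturated⇒top : ∀ v c → suc M ≤ ix v + c → c ≤ 1 → ix v ≡ M
  saturated⇒top v c sat c≤1 = ≤-antisym (ix≤M v)
    (≤-pred (≤-trans sat (≤-trans (+-monoʳ-≤ (ix v) c≤1) (≤-reflexive (+-comm (ix v) 1)))))

  head-top : ∀ {v vs} → FreeLinear (v ∷ vs) → ix v ≡ M
  head-top {v} fl = saturated⇒top v (b t) (head-saturated t fl (next-prev (layer v))) (b≤1 t)
    where
    t : Fin (suc n)
    t = prev (layer v)

  last-top : ∀ {v vs} → FreeLinear (v ∷ vs) → ix (lastOf v vs) ≡ M
  last-top {v} {vs} fl = saturated⇒top L (a (layer L)) (last-saturated fl) (a≤1 (layer L))
    where
    L : Vertex
    L = lastOf v vs

  -- A free linear component cannot have more than s = n + 1 vertices: the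
  -- vertex y reached from v₀ after s steps would coincide with v₀.
  no-long-free-path : ∀ v₀ v₁ vs → FreeLinear (v₀ ∷ v₁ ∷ vs) → n ≤ length vs → ⊥
  no-long-free-path v₀ v₁ vs fl n≤ =
    Unique[x∷xs]⇒x∉xs (LinearComponent.distinct linear) (subst (_∈ v₁ ∷ vs) y≡v₀ visited)
    where
    open FreeLinear fl
    path : Linked Edge (v₀ ∷ v₁ ∷ vs)
    path = LinearComponent.path linear
    open Landing (walk n v₁ vs n≤ (Linked.tail path))
    y : Vertex
    y = target

    y-layer : layer y ≡ layer v₀
    y-layer = trans inLayer
      (trans (cong (λ t → iterate next t n) (sym (proj₁ (edge-shift (Linked.head path)))))
             (next-period (layer v₀)))

    balance : Σ Vertex λ z → ix z + ix y ≡ ix (lastOf y remainder) + ix v₀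
    balance = parallel v₀ (v₁ ∷ vs) y remainder path onPath (sym y-layer)
      (m≤n⇒m≤1+n shorter) (+-comm (ix v₀) (ix y))

    z : Vertex
    z = proj₁ balance

    y-top : ix y ≡ M
    y-top = sum-of-tops (ix≤M z) (ix≤M y) (trans (proj₂ balance)
      (cong₂ _+_ (trans (cong ix sameLast) (last-top fl)) (head-top fl)))

    y≡v₀ : y ≡ v₀
    y≡v₀ = vertex-≡ (trans y-top (sym (head-top fl))) y-layer

  free-linear-bounded : ∀ vs → FreeLinear vs → length vs ≤ suc n
  free-linear-bounded []             _  = z≤n
  free-linear-bounded (_ ∷ [])       _  = s≤s z≤n
  free-linear-bounded (v₀ ∷ v₁ ∷ vs) fl with length (v₁ ∷ vs) ≤? n
  ... | yes short = s≤s short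
  ... | no long   = ⊥-elim (no-long-free-path v₀ v₁ vs fl (≤-pred (≰⇒> long)))

corollary4p4 : (m s : ℕ) → 1 ≤ m → 1 ≤ s →
    (ε : Fin s → ℤ) → (∀ t → ε t ≡ + 1 ⊎ ε t ≡ - (+ 1)) →
    (vs : List (Γ.Vertex m s ε)) → Γ.FreeLinear m s ε vs →
    length vs ≤ s
corollary4p4 zero    _       ()  _   _ _   _  _
corollary4p4 (suc _) zero    _   ()  _ _   _  _
corollary4p4 (suc M) (suc n) _   _   ε ε±1 vs fl = Signs.free-linear-bounded M n ε ε±1 vs fl
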